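{- Let $y$ be a disk of radius $R$ centered at a terminal $t$, and let $v$ be a vertex on the boundary of this disk. Then $\sum_{S:\ v\in\delta(S)} y(S)=R-\bigl(d^c(t,v)-c(v)\bigr)$.
   Context: $G=(V,E)$ is an undirected graph with vertex costs $c:V\to\mathbb{R}_{\ge0}$ and demands $\mathcal{L}$ consisting of vertex pairs $(s_i,t_i)$ with penalties $\pi_i\ge 0$; endpoints are called terminals and have cost zero. $d^{c}(u,v)$ is the minimum over $u$–$v$ paths of the total vertex cost including endpoints. $\delta(S)$ is the set of vertices outside $S$ with a neighbor in $S$. A core is a connected component of the subgraph induced by zero-cost vertices that contains an endpoint of a demand in $\mathcal{L}$. Dual variables $y(S)\ge 0$ are indexed by sets $S$ containing exactly one core and disjoint from the other cores; constraint (C1) requires $\sum_{S: v\in\delta(S)}y(S)\le c(v)$ for every vertex $v$. A disk of radius $R$ centered at terminal $t$ is the vector $y$ obtained by starting from $y=0$, $S=$ the core containing $t$, increasing $y(S)$ until (C1) is tight for some vertex $u$, adding $u$ to $S$, repeating, and stopping when $\sum_S y(S)=R$. A vertex $v$ is inside the disk if $d^c(t,v)<R$; $v$ is on the boundary if it is not inside but has a neighbor $u$ with $d^c(t,u)\le R$.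
   Formalization: The vertex costs, the penalties $\pi_i$, the radius R and the dual values y(S) are rational rather than real. -}

module Defs where

open import Data.Bool using (Bool; true; false; not; _∧_)
open import Data.Fin using (Fin)
open import Data.Fin.Subset using (Subset; _∈_; _∪_; ⁅_⁆; _⊆_)
open import Data.Vec using (lookup)
open import Data.List using (List; []; _∷_; _++_; [_]; allFin; foldr)
open import Data.Bool.ListAction using (any)
open import Data.List.Membership.Propositional renaming (_∈_ to _∈ₗ_)
open import Data.Nat using (ℕ)
open import Data.Product using (Σ; _×_; _,_; ∃; ∃-syntax)
open import Data.Rational using (ℚ; 0ℚ; _+_; _-_; _≤_; _<_)
open import Data.Sum using (_⊎_)
open import Relation.Nullary using (¬_)
open import Function.Bundles using (_⇔_)
open import Relation.Binary.PropositionalEquality using (_≡_)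

record Graph (n : ℕ) : Set where
  field
    adj    : Fin n → Fin n → Bool
    sym    : ∀ u v → adj u v ≡ adj v u
    irrefl : ∀ u → adj u u ≡ false

-- A demand (s , t , π): a vertex pair with a penalty.
Demand : ℕ → Set
Demand n = Fin n × Fin n × ℚ

module _ {n : ℕ} (G : Graph n) where
  open Graph G

  data Walk : Fin n → Fin n → Set where
    stop : (u : Fin n) → Walk u u
    step : (u : Fin n) {w v : Fin n} → adj u w ≡ true → Walk w v → Walk u v

  walkCost : (c : Fin n → ℚ) → ∀ {u v} → Walk u v → ℚ
  walkCost c (stop u) = c u
  walkCost c (step u _ p) = c u + walkCost c p

  AllZero : (c : Fin n → ℚ) → ∀ {u v} → Walk u v → Set
  AllZero c (stop u) = c u ≡ 0ℚ
  AllZero c (step u _ p) = (c u ≡ 0ℚ) × AllZero c p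

  -- d^c(u,v) = d : d is the minimum total vertex cost of a u–v walk
  -- (equivalently of a u–v path, since costs are nonnegative).
  IsDist : (c : Fin n → ℚ) → Fin n → Fin n → ℚ → Set
  IsDist c u v d =
    (Σ (Walk u v) λ p → walkCost c p ≡ d) × (∀ (p : Walk u v) → d ≤ walkCost c p)

  ZeroConn : (c : Fin n → ℚ) → Fin n → Fin n → Set
  ZeroConn c u w = Σ (Walk u w) (AllZero c)

  IsTerminal : List (Demand n) → Fin n → Set
  IsTerminal L x = ∃[ s ] ∃[ t ] ∃[ π ] ((s , t , π) ∈ₗ L × ((x ≡ s) ⊎ (x ≡ t)))

  IsCore : (c : Fin n → ℚ) → List (Demand n) → Subset n → Set
  IsCore c L C = ∃[ x ] (IsTerminal L x × c x ≡ 0ℚ × (∀ w → (w ∈ C) ⇔ ZeroConn c x w))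

  Admissible : (c : Fin n → ℚ) → List (Demand n) → Subset n → Set
  Admissible c L S =
    ∃[ C ] (IsCore c L C × C ⊆ S ×
      (∀ C' → IsCore c L C' → (∃[ w ] (w ∈ C' × w ∈ S)) → C' ≡ C))

  inδ : Subset n → Fin n → Bool
  inδ S v = not (lookup S v) ∧ any (λ u → lookup S u ∧ adj u v) (allFin n)

  -- A dual solution is represented by the list of its (set , value) entries
  -- with possibly non-zero value; all other y(S) are 0.
  DualList : Set
  DualList = List (Subset n × ℚ)

  load : DualList → Fin n → ℚ
  load ys v = foldr (λ { (S , a) r → if' (inδ S v) a r }) 0ℚ ys
    where
    if' : Bool → ℚ → ℚ → ℚ
    if' true  a r = a + r
    if' false a r = r

  total : DualList → ℚ
  total ys = foldr (λ { (S , a) r → a + r }) 0ℚ ys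

  FeasibleC1 : (c : Fin n → ℚ) → DualList → Set
  FeasibleC1 c ys = ∀ v → load ys v ≤ c v

  -- Reachable c L t S ys : the disk-growing process centred at t has
  -- completed the dual entries ys and its current set is S.
  data Reachable (c : Fin n → ℚ) (L : List (Demand n)) (t : Fin n)
       : Subset n → DualList → Set where
    start : (S₀ : Subset n) → (∀ w → (w ∈ S₀) ⇔ ZeroConn c t w) →
            Reachable c L t S₀ []
    grow  : ∀ {S ys} → Reachable c L t S ys →
            (a : ℚ) → 0ℚ ≤ a → Admissible c L S →
            FeasibleC1 c (ys ++ [ (S , a) ]) →
            (u : Fin n) → inδ S u ≡ true →
            load (ys ++ [ (S , a) ]) u ≡ c u →
            Reachable c L t (S ∪ ⁅ u ⁆) (ys ++ [ (S , a) ])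

  -- y is a disk of radius R centred at t: the process is run, and in the
  -- last phase y(S) is increased (without violating (C1)) until Σ_S y(S) = R.
  IsDisk : (c : Fin n → ℚ) → List (Demand n) → Fin n → ℚ → DualList → Set
  IsDisk c L t R y =
    ∃[ S ] ∃[ ys ] ∃[ a ]
      (Reachable c L t S ys × 0ℚ ≤ a × Admissible c L S ×
       y ≡ ys ++ [ (S , a) ] × FeasibleC1 c y × total y ≡ R)

  Inside : (c : Fin n → ℚ) → Fin n → ℚ → Fin n → Set
  Inside c t R v = ∃[ d ] (IsDist c t v d × d < R)

  OnBoundary : (c : Fin n → ℚ) → Fin n → ℚ → Fin n → Set
  OnBoundary c t R v =
    (¬ Inside c t R v) ×
    (∃[ u ] (adj u v ≡ true × ∃[ d ] (IsDist c t u d × d ≤ R)))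

{-# OPTIONS --safe #-}
module Submission where

-- While the disk grows, its current set S stays inside it: every w ∈ S has
-- d^c(t,w) ≤ Σ_S y(S) and load exactly c(w), every w ∈ δ(S) has
-- d^c(t,w) − c(w) ≤ Σ_S y(S) − load(w), and all other vertices carry no load.
-- A boundary vertex in S is thus at distance exactly R with load c(v); for any
-- other boundary vertex this bounds d^c(t,v) − c(v) by R − load(v). Conversely
-- every set in the support of y then contains t but not v, so each t–v walk
-- crosses all their boundaries and is charged at least R by the loads; by
-- (C1) the loads are at most the costs, giving R ≤ d^c(t,v) − c(v) + load(v).

open import Defs
open import Data.Nat using (ℕ)
open import Data.Fin using (Fin)
open import Data.List using (List)
open import Data.List.Membership.Propositional using (_∈_)
open import Data.Product using (_,_)
open import Data.Rational using (ℚ; 0ℚ; _≤_; _-_)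
open import Relation.Binary.PropositionalEquality using (_≡_)

open import Data.Bool using (true; false; if_then_else_; _∧_)
open import Data.Bool.Properties using (T-≡; T-∧)
open import Data.List using ([]; _∷_; _++_; [_]; allFin)
open import Data.List.Relation.Unary.All as All using (All; []; _∷_)
open import Data.List.Relation.Unary.All.Properties using (++⁺)
import Data.List.Relation.Unary.Any as Any
open import Data.List.Relation.Unary.Any.Properties using (any⁺; any⁻)
open import Data.List.Membership.Propositional.Properties using (∈-allFin)
open import Data.Fin.Subset using (Subset; _∪_; ⁅_⁆; _⊆_)
  renaming (_∈_ to _∈ₛ_; _∉_ to _∉ₛ_)
open import Data.Fin.Subset.Properties using (x∈p∪q⁻; p⊆p∪q; x∈⁅y⁆⇒x≡y; ⊆-refl; _∈?_)
open import Data.Vec using (lookup)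
open import Data.Vec.Properties using ([]=⇒lookup; lookup⇒[]=)
open import Data.Product using (Σ; _×_; ∃-syntax; proj₁; proj₂)
open import Data.Sum using (inj₁; inj₂)
open import Data.Empty using (⊥-elim)
open import Relation.Nullary using (yes; no)
open import Function.Bundles using (_⇔_; Equivalence)
open import Function using (case_of_)
open import Relation.Binary.PropositionalEquality using (refl; sym; trans; cong; cong₂)
open import Data.Rational using (_+_; -_)
import Data.Rational.Properties as ℚ
open ℚ.≤-Reasoning hiding (stop)
open import Data.Rational.Solver
open +-*-Solver

+-cancelʳ-≤ : ∀ {x y z : ℚ} → x + z ≤ y + z → x ≤ y
+-cancelʳ-≤ {x} {y} {z} x+z≤y+z = begin
  x          ≡⟨ solve 2 (λ x z → x := (x :+ z) :- z) refl x z ⟩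
  x + z - z  ≤⟨ ℚ.+-monoˡ-≤ (- z) x+z≤y+z ⟩
  y + z - z  ≡⟨ solve 2 (λ y z → (y :+ z) :- z := y) refl y z ⟩
  y          ∎

p≤q⇒p≤r+q : ∀ {p q r : ℚ} → 0ℚ ≤ r → p ≤ q → p ≤ r + q
p≤q⇒p≤r+q {p} {q} {r} 0≤r p≤q = begin
  p       ≡⟨ sym (ℚ.+-identityˡ p) ⟩
  0ℚ + p  ≤⟨ ℚ.+-mono-≤ 0≤r p≤q ⟩
  r + q   ∎

p≤q⇒p≤q+r : ∀ {p q r : ℚ} → 0ℚ ≤ r → p ≤ q → p ≤ q + r
p≤q⇒p≤q+r {p} {q} {r} 0≤r p≤q = begin
  p       ≡⟨ sym (ℚ.+-identityʳ p) ⟩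
  p + 0ℚ  ≤⟨ ℚ.+-mono-≤ p≤q 0≤r ⟩
  q + r   ∎

x+y≡z+w⇒x≡z-[y-w] : ∀ {x y z w : ℚ} → x + y ≡ z + w → x ≡ z - (y - w)
x+y≡z+w⇒x≡z-[y-w] {x} {y} {z} {w} eq = begin-equality
  x                ≡⟨ solve 2 (λ x y → x := (x :+ y) :- y) refl x y ⟩
  (x + y) - y      ≡⟨ cong (_- y) eq ⟩
  (z + w) - y      ≡⟨ solve 3 (λ z w y → (z :+ w) :- y := z :- (y :- w)) refl z w y ⟩
  z - (y - w)      ∎

module _ {n : ℕ} (G : Graph n) where
  open Graph G using (adj)

  ∈δ⁺ : ∀ {S x w} → x ∈ₛ S → adj x w ≡ true → w ∉ₛ S → inδ G S w ≡ true
  ∈δ⁺ {S} {x} {w} x∈S e w∉S with lookup S w in eq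
  ... | true  = ⊥-elim (w∉S (lookup⇒[]= w S eq))
  ... | false = Equivalence.to T-≡ (any⁺ (λ u → lookup S u ∧ adj u w)
        (Any.map
          (λ { refl → Equivalence.from T-∧
                 (Equivalence.from T-≡ ([]=⇒lookup x∈S) , Equivalence.from T-≡ e) })
          (∈-allFin x)))

  ∈δ⁻ : ∀ {S w} → inδ G S w ≡ true → w ∉ₛ S × ∃[ x ] (x ∈ₛ S × adj x w ≡ true)
  ∈δ⁻ {S} {w} w∈δS with lookup S w in eq
  ∈δ⁻ () | true
  ... | false with Any.satisfied (any⁻ (λ u → lookup S u ∧ adj u w) (allFin n) (Equivalence.from T-≡ w∈δS))
  ... | x , x∈S∧adj =
    (λ w∈S → case trans (sym ([]=⇒lookup w∈S)) eq of λ ()) ,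
    x , lookup⇒[]= x S (Equivalence.to T-≡ (proj₁ (Equivalence.to T-∧ x∈S∧adj))) ,
    Equivalence.to T-≡ (proj₂ (Equivalence.to T-∧ x∈S∧adj))

  δ-mono : ∀ {S S' w} → S ⊆ S' → w ∉ₛ S' → inδ G S w ≡ true → inδ G S' w ≡ true
  δ-mono S⊆S' w∉S' w∈δS = let (_ , x , x∈S , e) = ∈δ⁻ w∈δS in ∈δ⁺ (S⊆S' x∈S) e w∉S'

  ∈⇒∉δ : ∀ {S w} → w ∈ₛ S → inδ G S w ≡ false
  ∈⇒∉δ {S} {w} w∈S with inδ G S w in eq
  ... | true  = ⊥-elim (proj₁ (∈δ⁻ eq) w∈S)
  ... | false = refl

  contribution : Subset n → ℚ → Fin n → ℚ
  contribution S a w = if inδ G S w then a else 0ℚ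

  contribution-nonneg : ∀ S {a} w → 0ℚ ≤ a → 0ℚ ≤ contribution S a w
  contribution-nonneg S w 0≤a with inδ G S w
  ... | true  = 0≤a
  ... | false = ℚ.≤-refl

  load-∷ : ∀ S a ys w → load G ((S , a) ∷ ys) w ≡ contribution S a w + load G ys w
  load-∷ S a ys w with inδ G S w
  ... | true  = refl
  ... | false = sym (ℚ.+-identityˡ _)

  load-snoc : ∀ ys S a w → load G (ys ++ [ (S , a) ]) w ≡ load G ys w + contribution S a w
  load-snoc [] S a w = begin-equality
    load G [ (S , a) ] w     ≡⟨ load-∷ S a [] w ⟩
    contribution S a w + 0ℚ  ≡⟨ ℚ.+-comm (contribution S a w) 0ℚ ⟩
    0ℚ + contribution S a w  ∎
  load-snoc ((S' , b) ∷ ys) S a w = begin-equality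
    load G ((S' , b) ∷ ys ++ [ (S , a) ]) w
      ≡⟨ load-∷ S' b (ys ++ [ (S , a) ]) w ⟩
    contribution S' b w + load G (ys ++ [ (S , a) ]) w
      ≡⟨ cong (contribution S' b w +_) (load-snoc ys S a w) ⟩
    contribution S' b w + (load G ys w + contribution S a w)
      ≡⟨ sym (ℚ.+-assoc (contribution S' b w) (load G ys w) (contribution S a w)) ⟩
    (contribution S' b w + load G ys w) + contribution S a w
      ≡⟨ cong (_+ contribution S a w) (sym (load-∷ S' b ys w)) ⟩
    load G ((S' , b) ∷ ys) w + contribution S a w  ∎

  load-snoc-δ : ∀ ys {S} a {w} → inδ G S w ≡ true →
                load G (ys ++ [ (S , a) ]) w ≡ load G ys w + a
  load-snoc-δ ys {S} a {w} w∈δS with load-snoc ys S a w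
  ... | eq rewrite w∈δS = eq

  load-snoc-∉δ : ∀ ys {S} a {w} → inδ G S w ≡ false →
                 load G (ys ++ [ (S , a) ]) w ≡ load G ys w
  load-snoc-∉δ ys {S} a {w} w∉δS with load-snoc ys S a w
  ... | eq rewrite w∉δS = trans eq (ℚ.+-identityʳ _)

  total-snoc : ∀ ys S a → total G (ys ++ [ (S , a) ]) ≡ total G ys + a
  total-snoc [] S a = trans (ℚ.+-identityʳ a) (sym (ℚ.+-identityˡ a))
  total-snoc ((S' , b) ∷ ys) S a =
    trans (cong (b +_) (total-snoc ys S a)) (sym (ℚ.+-assoc b _ a))

  snoc : ∀ {x u v} → Walk G x u → adj u v ≡ true → Walk G x v
  snoc (stop x) e = step x e (stop _)
  snoc (step x e' p) e = step x e' (snoc p e)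

  walkCost-snoc : ∀ (f : Fin n → ℚ) {x u v} (p : Walk G x u) (e : adj u v ≡ true) →
                  walkCost G f (snoc p e) ≡ walkCost G f p + f v
  walkCost-snoc f (stop x) e = refl
  walkCost-snoc f (step x e' p) e =
    trans (cong (f x +_) (walkCost-snoc f p e)) (sym (ℚ.+-assoc (f x) _ _))

  walkCost-allZero : ∀ (c : Fin n → ℚ) {x u} (p : Walk G x u) → AllZero G c p →
                     walkCost G c p ≡ 0ℚ
  walkCost-allZero c (stop x) cx≡0 = cx≡0
  walkCost-allZero c (step x e p) (cx≡0 , p-zero)
    rewrite cx≡0 | walkCost-allZero c p p-zero = refl

  allZero-last : ∀ (c : Fin n → ℚ) {x u} (p : Walk G x u) → AllZero G c p → c u ≡ 0ℚ
  allZero-last c (stop x) cx≡0 = cx≡0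
  allZero-last c (step x e p) (_ , p-zero) = allZero-last c p p-zero

  walkCost-nonneg : ∀ {f : Fin n → ℚ} → (∀ x → 0ℚ ≤ f x) →
                    ∀ {x u} (p : Walk G x u) → 0ℚ ≤ walkCost G f p
  walkCost-nonneg f≥0 (stop x) = f≥0 x
  walkCost-nonneg f≥0 (step x e p) = p≤q⇒p≤r+q (f≥0 x) (walkCost-nonneg f≥0 p)

  walkCost-start : ∀ {f : Fin n → ℚ} → (∀ x → 0ℚ ≤ f x) →
                   ∀ {x u} (p : Walk G x u) → f x ≤ walkCost G f p
  walkCost-start f≥0 (stop x) = ℚ.≤-refl
  walkCost-start f≥0 (step x e p) = p≤q⇒p≤q+r (walkCost-nonneg f≥0 p) ℚ.≤-refl

  walkCost-+ : ∀ (f g h : Fin n → ℚ) → (∀ x → h x ≡ f x + g x) →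
               ∀ {x u} (p : Walk G x u) → walkCost G h p ≡ walkCost G f p + walkCost G g p
  walkCost-+ f g h h≡f+g (stop x) = h≡f+g x
  walkCost-+ f g h h≡f+g (step x e p) = begin-equality
    h x + walkCost G h p
      ≡⟨ cong₂ _+_ (h≡f+g x) (walkCost-+ f g h h≡f+g p) ⟩
    (f x + g x) + (walkCost G f p + walkCost G g p)
      ≡⟨ solve 4 (λ a b c d → (a :+ b) :+ (c :+ d) := (a :+ c) :+ (b :+ d))
               refl (f x) (g x) (walkCost G f p) (walkCost G g p) ⟩
    (f x + walkCost G f p) + (g x + walkCost G g p)  ∎

  -- cost_f(p) − f(u) ≤ cost_g(p) − g(u), written without subtraction.
  walkCost-exchange-last : ∀ {f g : Fin n → ℚ} → (∀ x → f x ≤ g x) →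
                           ∀ {x u} (p : Walk G x u) → walkCost G f p + g u ≤ walkCost G g p + f u
  walkCost-exchange-last {f} {g} f≤g (stop x) = ℚ.≤-reflexive (ℚ.+-comm (f x) (g x))
  walkCost-exchange-last {f} {g} f≤g {u = u} (step x e p) = begin
    f x + walkCost G f p + g u    ≡⟨ ℚ.+-assoc (f x) _ (g u) ⟩
    f x + (walkCost G f p + g u)  ≤⟨ ℚ.+-mono-≤ (f≤g x) (walkCost-exchange-last f≤g p) ⟩
    g x + (walkCost G g p + f u)  ≡⟨ sym (ℚ.+-assoc (g x) _ (f u)) ⟩
    g x + walkCost G g p + f u    ∎

  -- The first vertex of p outside S lies in δ(S).
  a≤walkCost-contribution : ∀ S {a} → 0ℚ ≤ a → ∀ {x w} (p : Walk G x w) →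
                            x ∈ₛ S → w ∉ₛ S → a ≤ walkCost G (contribution S a) p
  a≤walkCost-contribution S 0≤a (stop x) x∈S x∉S = ⊥-elim (x∉S x∈S)
  a≤walkCost-contribution S {a} 0≤a (step x {w'} e p) x∈S w∉S
    with w' ∈? S
  ... | yes w'∈S = p≤q⇒p≤r+q (contribution-nonneg S x 0≤a)
                     (a≤walkCost-contribution S 0≤a p w'∈S w∉S)
  ... | no w'∉S = p≤q⇒p≤r+q (contribution-nonneg S x 0≤a) (begin
    a                                 ≡⟨ sym (cong (if_then a else 0ℚ) (∈δ⁺ x∈S e w'∉S)) ⟩
    contribution S a w'               ≤⟨ walkCost-start (λ z → contribution-nonneg S z 0≤a) p ⟩
    walkCost G (contribution S a) p   ∎)

  SeparatingEntry : Fin n → Fin n → Subset n × ℚ → Set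
  SeparatingEntry t v (S , a) = 0ℚ ≤ a × t ∈ₛ S × v ∉ₛ S

  total≤walkCost-load : ∀ {t v} (ys : DualList G) → All (SeparatingEntry t v) ys →
                        (p : Walk G t v) → total G ys ≤ walkCost G (load G ys) p
  total≤walkCost-load [] [] p = walkCost-nonneg (λ _ → ℚ.≤-refl) p
  total≤walkCost-load ((S , a) ∷ ys) ((0≤a , t∈S , v∉S) ∷ separating) p = begin
    a + total G ys
      ≤⟨ ℚ.+-mono-≤ (a≤walkCost-contribution S 0≤a p t∈S v∉S)
                    (total≤walkCost-load ys separating p) ⟩
    walkCost G (contribution S a) p + walkCost G (load G ys) p
      ≡⟨ sym (walkCost-+ (contribution S a) (load G ys) (load G ((S , a) ∷ ys)) (load-∷ S a ys) p) ⟩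
    walkCost G (load G ((S , a) ∷ ys)) p  ∎

  total+cost≤load+walkCost : ∀ (c : Fin n → ℚ) {t v} (ys : DualList G) →
                             FeasibleC1 G c ys → All (SeparatingEntry t v) ys → (p : Walk G t v) →
                             total G ys + c v ≤ load G ys v + walkCost G c p
  total+cost≤load+walkCost c {v = v} ys feasible separating p = begin
    total G ys + c v                ≤⟨ ℚ.+-monoˡ-≤ (c v) (total≤walkCost-load ys separating p) ⟩
    walkCost G (load G ys) p + c v  ≤⟨ walkCost-exchange-last feasible p ⟩
    walkCost G c p + load G ys v    ≡⟨ ℚ.+-comm _ (load G ys v) ⟩
    load G ys v + walkCost G c p    ∎

  module _ (c : Fin n → ℚ) (t : Fin n) where

    record DiskInvariant (S : Subset n) (ys : DualList G) : Set where
      field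
        center∈      : t ∈ₛ S
        entries      : All (λ { (S' , a) → 0ℚ ≤ a × t ∈ₛ S' × S' ⊆ S }) ys
        reach-∈      : ∀ {w} → w ∈ₛ S →
                       Σ (Walk G t w) λ p → walkCost G c p ≤ total G ys
        reach-δ      : ∀ {w} → inδ G S w ≡ true →
                       Σ (Walk G t w) λ p → walkCost G c p + load G ys w ≤ total G ys + c w
        load-∈       : ∀ {w} → w ∈ₛ S → load G ys w ≡ c w
        load-outside : ∀ {w} → w ∉ₛ S → inδ G S w ≡ false → load G ys w ≡ 0ℚ

    invariant-start : ∀ {S₀} → c t ≡ 0ℚ → (∀ w → (w ∈ₛ S₀) ⇔ ZeroConn G c t w) →
                      DiskInvariant S₀ []
    invariant-start {S₀} ct≡0 S₀-core = record
      { center∈      = Equivalence.from (S₀-core t) (stop t , ct≡0)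
      ; entries      = []
      ; reach-∈      = λ w∈S₀ → let (p , p-zero) = zero-walk w∈S₀ in
                         p , ℚ.≤-reflexive (walkCost-allZero c p p-zero)
      ; reach-δ      = reach-δ
      ; load-∈       = λ w∈S₀ → let (p , p-zero) = zero-walk w∈S₀ in
                         sym (allZero-last c p p-zero)
      ; load-outside = λ _ _ → refl
      }
      where
      zero-walk : ∀ {w} → w ∈ₛ S₀ → ZeroConn G c t w
      zero-walk {w} = Equivalence.to (S₀-core w)

      reach-δ : ∀ {w} → inδ G S₀ w ≡ true → Σ (Walk G t w) λ p → walkCost G c p + 0ℚ ≤ 0ℚ + c w
      reach-δ {w} w∈δS₀ with ∈δ⁻ {S₀} w∈δS₀
      ... | _ , x , x∈S₀ , e with zero-walk x∈S₀
      ... | p , p-zero = snoc p e , ℚ.≤-reflexive (begin-equality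
        walkCost G c (snoc p e) + 0ℚ  ≡⟨ ℚ.+-identityʳ _ ⟩
        walkCost G c (snoc p e)       ≡⟨ walkCost-snoc c p e ⟩
        walkCost G c p + c w          ≡⟨ cong (_+ c w) (walkCost-allZero c p p-zero) ⟩
        0ℚ + c w                      ∎)

    raise : ∀ {S ys a} → DiskInvariant S ys → 0ℚ ≤ a → DiskInvariant S (ys ++ [ (S , a) ])
    raise {S} {ys} {a} inv 0≤a = record
      { center∈      = center∈
      ; entries      = ++⁺ entries ((0≤a , center∈ , ⊆-refl) ∷ [])
      ; reach-∈      = reach-∈′
      ; reach-δ      = reach-δ′
      ; load-∈       = λ w∈S → trans (load-snoc-∉δ ys a (∈⇒∉δ w∈S)) (load-∈ w∈S)
      ; load-outside = λ w∉S w∉δS → trans (load-snoc-∉δ ys a w∉δS) (load-outside w∉S w∉δS)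
      }
      where
      open DiskInvariant inv

      reach-∈′ : ∀ {w} → w ∈ₛ S →
                 Σ (Walk G t w) λ p → walkCost G c p ≤ total G (ys ++ [ (S , a) ])
      reach-∈′ w∈S = let (p , p≤total) = reach-∈ w∈S in
        p , ℚ.≤-trans (p≤q⇒p≤q+r 0≤a p≤total) (ℚ.≤-reflexive (sym (total-snoc ys S a)))

      reach-δ′ : ∀ {w} → inδ G S w ≡ true →
                 Σ (Walk G t w) λ p →
                   walkCost G c p + load G (ys ++ [ (S , a) ]) w ≤ total G (ys ++ [ (S , a) ]) + c w
      reach-δ′ {w} w∈δS = let (p , bound) = reach-δ w∈δS in p , (begin
        walkCost G c p + load G (ys ++ [ (S , a) ]) w
          ≡⟨ cong (walkCost G c p +_) (load-snoc-δ ys a w∈δS) ⟩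
        walkCost G c p + (load G ys w + a)
          ≡⟨ sym (ℚ.+-assoc (walkCost G c p) (load G ys w) a) ⟩
        walkCost G c p + load G ys w + a
          ≤⟨ ℚ.+-monoˡ-≤ a bound ⟩
        total G ys + c w + a
          ≡⟨ solve 3 (λ x y z → (x :+ y) :+ z := (x :+ z) :+ y) refl (total G ys) (c w) a ⟩
        total G ys + a + c w
          ≡⟨ cong (_+ c w) (sym (total-snoc ys S a)) ⟩
        total G (ys ++ [ (S , a) ]) + c w  ∎)

    extend : ∀ {S ys u} → DiskInvariant S ys → inδ G S u ≡ true → load G ys u ≡ c u →
             DiskInvariant (S ∪ ⁅ u ⁆) ys
    extend {S} {ys} {u} inv u∈δS tight = record
      { center∈      = S⊆S′ center∈
      ; entries      = All.map (λ { (0≤a , t∈S″ , S″⊆S) → 0≤a , t∈S″ , λ {x} x∈S″ → S⊆S′ (S″⊆S x∈S″) }) entries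
      ; reach-∈      = reach-∈′
      ; reach-δ      = reach-δ′
      ; load-∈       = load-∈′
      ; load-outside = load-outside′
      }
      where
      open DiskInvariant inv
      S′ = S ∪ ⁅ u ⁆

      S⊆S′ : S ⊆ S′
      S⊆S′ = p⊆p∪q ⁅ u ⁆

      reach-∈′ : ∀ {w} → w ∈ₛ S′ → Σ (Walk G t w) λ p → walkCost G c p ≤ total G ys
      reach-∈′ w∈S′ with x∈p∪q⁻ S ⁅ u ⁆ w∈S′
      ... | inj₁ w∈S = reach-∈ w∈S
      ... | inj₂ w∈⁅u⁆ with x∈⁅y⁆⇒x≡y u w∈⁅u⁆
      ... | refl = let (p , bound) = reach-δ u∈δS in
        p , +-cancelʳ-≤ (ℚ.≤-trans bound (ℚ.≤-reflexive (cong (total G ys +_) (sym tight))))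

      load-∈′ : ∀ {w} → w ∈ₛ S′ → load G ys w ≡ c w
      load-∈′ w∈S′ with x∈p∪q⁻ S ⁅ u ⁆ w∈S′
      ... | inj₁ w∈S = load-∈ w∈S
      ... | inj₂ w∈⁅u⁆ with x∈⁅y⁆⇒x≡y u w∈⁅u⁆
      ... | refl = tight

      reach-δ′ : ∀ {w} → inδ G S′ w ≡ true →
                 Σ (Walk G t w) λ p → walkCost G c p + load G ys w ≤ total G ys + c w
      reach-δ′ {w} w∈δS′ with inδ G S w in w-δS | ∈δ⁻ {S′} w∈δS′
      ... | true  | _ = reach-δ w-δS
      ... | false | w∉S′ , x , x∈S′ , e =
        let (p , p≤total) = reach-∈′ x∈S′ in snoc p e , (begin
          walkCost G c (snoc p e) + load G ys w
            ≡⟨ cong₂ _+_ (walkCost-snoc c p e) (load-outside (λ w∈S → w∉S′ (S⊆S′ w∈S)) w-δS) ⟩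
          walkCost G c p + c w + 0ℚ
            ≡⟨ ℚ.+-identityʳ _ ⟩
          walkCost G c p + c w
            ≤⟨ ℚ.+-monoˡ-≤ (c w) p≤total ⟩
          total G ys + c w  ∎)

      load-outside′ : ∀ {w} → w ∉ₛ S′ → inδ G S′ w ≡ false → load G ys w ≡ 0ℚ
      load-outside′ {w} w∉S′ w∉δS′ with inδ G S w in w-δS
      ... | true  with () ← trans (sym w∉δS′) (δ-mono S⊆S′ w∉S′ w-δS)
      ... | false = load-outside (λ w∈S → w∉S′ (S⊆S′ w∈S)) w-δS

    invariant : ∀ {L S ys} → c t ≡ 0ℚ → Reachable G c L t S ys → DiskInvariant S ys
    invariant ct≡0 (start S₀ S₀-core) = invariant-start ct≡0 S₀-core
    invariant ct≡0 (grow r a 0≤a _ _ u u∈δS tight) =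
      extend (raise (invariant ct≡0 r) 0≤a) u∈δS tight

    boundary-load : ∀ {S y v d} → DiskInvariant S y → FeasibleC1 G c y →
                    OnBoundary G c t (total G y) v → IsDist G c t v d →
                    load G y v + d ≡ total G y + c v
    boundary-load {S} {y} {v} {d} inv feasible
                  (not-inside , u , u~v , du , ((pᵤ , pᵤ≡du) , _) , du≤R)
                  dist@((p₀ , p₀≡d) , d-min)
      with v ∈? S
    ... | yes v∈S = begin-equality
      load G y v + d   ≡⟨ cong₂ _+_ (load-∈ v∈S) (ℚ.≤-antisym d≤R R≤d) ⟩
      c v + total G y  ≡⟨ ℚ.+-comm (c v) (total G y) ⟩
      total G y + c v  ∎
      where
      open DiskInvariant inv
      R≤d : total G y ≤ d
      R≤d = ℚ.≮⇒≥ (λ d<R → not-inside (d , dist , d<R))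
      d≤R : d ≤ total G y
      d≤R = let (p , p≤R) = reach-∈ v∈S in ℚ.≤-trans (d-min p) p≤R
    ... | no v∉S = ℚ.≤-antisym upper lower
      where
      open DiskInvariant inv
      separating : All (SeparatingEntry t v) y
      separating = All.map (λ { (0≤a , t∈S′ , S′⊆S) → 0≤a , t∈S′ , λ v∈S′ → v∉S (S′⊆S v∈S′) })
                           entries

      lower : total G y + c v ≤ load G y v + d
      lower = ℚ.≤-trans (total+cost≤load+walkCost c y feasible separating p₀)
                        (ℚ.≤-reflexive (cong (load G y v +_) p₀≡d))

      upper : load G y v + d ≤ total G y + c v
      upper with inδ G S v in v-δS
      ... | true = let (p , bound) = reach-δ v-δS in begin
        load G y v + d               ≤⟨ ℚ.+-monoʳ-≤ (load G y v) (d-min p) ⟩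
        load G y v + walkCost G c p  ≡⟨ ℚ.+-comm (load G y v) _ ⟩
        walkCost G c p + load G y v  ≤⟨ bound ⟩
        total G y + c v              ∎
      ... | false = begin
        load G y v + d                ≡⟨ cong (_+ d) (load-outside v∉S v-δS) ⟩
        0ℚ + d                        ≡⟨ ℚ.+-identityˡ d ⟩
        d                             ≤⟨ d-min (snoc pᵤ u~v) ⟩
        walkCost G c (snoc pᵤ u~v)    ≡⟨ walkCost-snoc c pᵤ u~v ⟩
        walkCost G c pᵤ + c v         ≡⟨ cong (_+ c v) pᵤ≡du ⟩
        du + c v                      ≤⟨ ℚ.+-monoˡ-≤ (c v) du≤R ⟩
        total G y + c v               ∎

lemma2 : {n : ℕ} (G : Graph n) (c : Fin n → ℚ) (L : List (Demand n)) →
    (∀ v → 0ℚ ≤ c v) →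
    (∀ {s t π} → (s , t , π) ∈ L → 0ℚ ≤ π) →
    (∀ x → IsTerminal G L x → c x ≡ 0ℚ) →
    (t : Fin n) → IsTerminal G L t →
    (R : ℚ) (y : DualList G) → IsDisk G c L t R y →
    (v : Fin n) → OnBoundary G c t R v →
    (d : ℚ) → IsDist G c t v d →
    load G y v ≡ R - (d - c v)
lemma2 G c L _ _ terminal-cost t t-terminal R y
       (S , ys , a , reachable , 0≤a , _ , refl , feasible , refl) v boundary d dist =
  x+y≡z+w⇒x≡z-[y-w] {z = total G y} {w = c v} (boundary-load G c t disk feasible boundary dist)
  where
  disk : DiskInvariant G c t S y
  disk = raise G c t (invariant G c t (terminal-cost t t-terminal) reachable) 0≤a
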